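{- Let $n,m\ge 0$ be integers and $x,y\in[-n,m]$ with $0\le x\le y$. Then $x^\ast\ge y^\ast$.
   Context: $[-n,m]=\{x\in\mathbb Z:-n\le x\le m\}$; $p(x)=x-1$ if $x>-n$, $p(-n)=-n$; $x^\ast$ is defined recursively by $0^\ast=m$, $x^\ast=x$ for $x<0$, and $x^\ast=p((p(x))^\ast)$ for $x>0$. -}

module Defs where

open import Data.Nat using (ℕ; zero; suc)
open import Data.Integer using (ℤ; +_; -[1+_]; -_; _-_; _<?_)
open import Relation.Nullary using (yes; no)

p : ℕ → ℤ → ℤ
p n x with - (+ n) <? x
... | yes _ = x - + 1
... | no  _ = - (+ n)

-- x* with parameters n, m:
--   0* = m,  x* = x for x < 0,  x* = p((p x)*) for x > 0.
-- For x = k+1 > 0 we have x > -n, so p x = k; hence (k+1)* = p(k*).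
star : ℕ → ℕ → ℤ → ℤ
star n m (+ zero)    = + m
star n m (+ suc k)   = p n (star n m (+ k))
star n m -[1+ k ]    = -[1+ k ]

module Submission where

-- Two facts about p suffice:
--   * p never goes below -n, and
--   * p is deflationary on [-n, ∞): p z ≤ z whenever -n ≤ z.
-- Since m ≥ -n, every k* lies in [-n, ∞) (induction on k), so each step
-- satisfies (k+1)* ≤ k*.  A sequence that decreases at each step is
-- antitone, so 0 ≤ x ≤ y gives y* ≤ x*.

open import Defs
open import Data.Nat using (ℕ; zero; suc; z≤n; s≤s) renaming (_≤_ to _≤ℕ_)
import Data.Nat.Properties as ℕ
open import Data.Integer using (ℤ; +_; -_; _≤_; _-_; _<?_; +≤+; -≤+; pred)
open import Data.Integer.Properties
  using (≤-refl; ≤-trans; i<j⇒i≤pred[j]; i≤j⇒pred[i]≤j; +-comm)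
open import Data.Product using (_×_)
open import Data.Sum using (inj₁; inj₂)
open import Relation.Nullary using (yes; no)
open import Relation.Binary.PropositionalEquality using (_≡_; refl; subst)

pred≡minus-one : ∀ z → pred z ≡ z - + 1
pred≡minus-one z = +-comm (- + 1) z

p-lower-bound : ∀ n z → - (+ n) ≤ p n z
p-lower-bound n z with - (+ n) <? z
... | yes -n<z = subst (- (+ n) ≤_) (pred≡minus-one z) (i<j⇒i≤pred[j] -n<z)
... | no  _    = ≤-refl

p-deflationary : ∀ n z → - (+ n) ≤ z → p n z ≤ z
p-deflationary n z -n≤z with - (+ n) <? z
... | yes _ = subst (_≤ z) (pred≡minus-one z) (i≤j⇒pred[i]≤j ≤-refl)
... | no  _ = -n≤z

-n≤+m : ∀ n m → - (+ n) ≤ + m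
-n≤+m zero    m = +≤+ z≤n
-n≤+m (suc n) m = -≤+

star-lower-bound : ∀ n m k → - (+ n) ≤ star n m (+ k)
star-lower-bound n m zero    = -n≤+m n m
star-lower-bound n m (suc k) = p-lower-bound n (star n m (+ k))

star-step : ∀ n m k → star n m (+ suc k) ≤ star n m (+ k)
star-step n m k = p-deflationary n (star n m (+ k)) (star-lower-bound n m k)

antitone-from-step : (f : ℕ → ℤ) → (∀ k → f (suc k) ≤ f k) →
                     ∀ {a b} → a ≤ℕ b → f b ≤ f a
antitone-from-step f step {a} {zero}  z≤n  = ≤-refl
antitone-from-step f step {a} {suc b} a≤1+b with ℕ.m≤n⇒m<n∨m≡n a≤1+b
... | inj₂ refl     = ≤-refl
... | inj₁ (s≤s a≤b) = ≤-trans (step b) (antitone-from-step f step a≤b)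

lemma4p6 : (n m : ℕ) (x y : ℤ) →
    (- (+ n) ≤ x × x ≤ + m) → (- (+ n) ≤ y × y ≤ + m) →
    + 0 ≤ x → x ≤ y →
    star n m y ≤ star n m x
lemma4p6 n m (+ a) (+ b) _ _ _ (+≤+ a≤b) =
  antitone-from-step (λ k → star n m (+ k)) (star-step n m) a≤b
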